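{- Let $\Delta$ be a 3-colored simplicial complex and let $\Gamma\in\mathcal{A}(\Delta)$ with $j_{p(\Gamma)}(\Gamma)\ge j_{q(\Gamma)}(\Gamma)$. Let $\Gamma_1$ be the complex constructed with parameters $g_i(\Gamma_1)=g_i(\Gamma)$ for all $i\in[3]$, $p(\Gamma_1)=q(\Gamma)$ and $q(\Gamma_1)=p(\Gamma)$. Then $\Gamma_1\in\mathcal{A}(\Delta)$ and $f_{123}(\Gamma_1)\ge f_{123}(\Gamma)$. Furthermore, if $\Gamma\in\mathcal{D}(\Delta)$, then $\Gamma_1\in\mathcal{D}(\Delta)$.
   Context: A 3-colored simplicial complex is a finite simplicial complex with a coloring of its vertices by $[3]=\{1,2,3\}$ such that no face contains two vertices of the same color. $f_S(\Delta)$ is the number of faces with color set exactly $S\subseteq[3]$ (written $f_1,f_{12},f_{123}$, etc.; $f_{ij}=f_{\{i,j\}}$). Faces with color set $[3]$ are facets. Complexes are assumed to have $f_S>0$ for all $S$. Vertices of color $i$ are labeled $v^i_1,v^i_2,\dots$. Construction: given $\Delta$, positive integers $g_1,g_2,g_3$ and distinct $p,q\in[3]$, build $\Gamma$ as follows. Start with vertices $v^i_1,\dots,v^i_{g_i}$ for each $i$, every two of distinct colors adjacent. If $f_p(\Delta)>g_p$, add $v^p_{g_p+1}$ and, for each color $c\ne p$, join it to the first $k_c$ present vertices of color $c$, with $k_c$ as large as possible so that the number of edges of color set $\{p,c\}$ does not exceed $f_{pc}(\Delta)$. Then, if $f_q(\Delta)>g_q$, add $v^q_{g_q+1}$ and join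 it in the same way (the present vertices of color $p$ including $v^p_{g_p+1}$ if added). Faces: empty set, vertices, edges, all triples of pairwise adjacent vertices. Write $g_i(\Gamma),p(\Gamma),q(\Gamma)$ for the parameters. $\mathcal{A}(\Delta)$ is the set of all complexes (with parameters) so constructed that are well defined and satisfy $f_S(\Gamma)\le f_S(\Delta)$ for all $S\ne[3]$. $m(\Delta)=\max\{f_{123}(\Gamma):\Gamma\in\mathcal{A}(\Delta)\}$; $\mathcal{B}(\Delta)=\{\Gamma\in\mathcal{A}(\Delta):f_{123}(\Gamma)=m(\Delta)\}$; $n(\Delta)=\max\{f_{12}(\Gamma)+f_{13}(\Gamma)+f_{23}(\Gamma):\Gamma\in\mathcal{B}(\Delta)\}$; $\mathcal{C}(\Delta)=\{\Gamma\in\mathcal{B}(\Delta):f_{12}(\Gamma)+f_{13}(\Gamma)+f_{23}(\Gamma)=n(\Delta)\}$; $\mathcal{D}(\Delta)=\{\Gamma\in\mathcal{C}(\Delta): f_{123}(\Gamma)<\min\{f_1(\Delta)f_{23}(\Delta),f_2(\Delta)f_{13}(\Delta),f_3(\Delta)f_{12}(\Delta)\}\}$. For $\Gamma\in\mathcal{A}(\Delta)$ set $j_1(\Gamma)=f_{23}(\Delta)-g_2(\Gamma)g_3(\Gamma)$, $j_2(\Gamma)=f_{13}(\Delta)-g_1(\Gamma)g_3(\Gamma)$, $j_3(\Gamma)=f_{12}(\Delta)-g_1(\Gamma)g_2(\Gamma)$. -}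

module Defs where

open import Data.Bool using (Bool; true; false; T; _∧_; if_then_else_)
open import Data.Nat using (ℕ; zero; suc; _+_; _*_; _∸_; _≤_; _<_; _<ᵇ_; _⊓_)
open import Data.Integer as ℤ using (ℤ; +_)
open import Data.Fin as Fin using (Fin; toℕ)
open import Data.Fin.Subset using (Subset; ⁅_⁆; _∪_; ⊤)
open import Data.Maybe using (Maybe; just; nothing)
open import Data.List using (List; []; _∷_; map; concatMap)
open import Data.Nat.ListAction using (sum)
open import Data.List.Base using (allFin)
open import Data.Vec using (tabulate)
open import Data.Vec.Properties using (≡-dec)
import Data.Bool as B
open import Data.Maybe using (is-just)
open import Data.Product using (_×_)
open import Data.Sum using (_⊎_)
open import Relation.Nullary using (¬_)
open import Relation.Nullary.Decidable using (⌊_⌋)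
open import Relation.Binary.PropositionalEquality using (_≡_; _≢_)

-- Colours: [3] = {1,2,3} is represented by Fin 3 (colour i ↦ i-1).
-- Colour sets S ⊆ [3] are Subset 3.

Colour : Set
Colour = Fin 3

c₁ c₂ c₃ : Colour
c₁ = Fin.zero
c₂ = Fin.suc Fin.zero
c₃ = Fin.suc (Fin.suc Fin.zero)

-- A 3-coloured vertex set: n i vertices of colour i, namely v^i_1,…,v^i_{n i}
-- (represented by Fin (n i); v^i_{k+1} ↦ k).
-- A face of a 3-coloured complex has at most one vertex of each colour:
Face : (Colour → ℕ) → Set
Face n = (i : Colour) → Maybe (Fin (n i))

colours : ∀ {n} → Face n → Subset 3
colours σ = tabulate (λ i → is-just (σ i))

_⊑_ : ∀ {n} → Face n → Face n → Set
τ ⊑ σ = ∀ i → τ i ≡ nothing ⊎ τ i ≡ σ i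

single : ∀ {n} (i : Colour) → Fin (n i) → Face n
single {n} i v j with i Fin.≟ j
... | Relation.Nullary.yes _≡_.refl = just v
... | Relation.Nullary.no _ = nothing

private
  opts : (m : ℕ) → List (Maybe (Fin m))
  opts m = nothing ∷ map just (allFin m)

  mk : ∀ {n} → Maybe (Fin (n c₁)) → Maybe (Fin (n c₂)) → Maybe (Fin (n c₃)) → Face n
  mk x y z Fin.zero = x
  mk x y z (Fin.suc Fin.zero) = y
  mk x y z (Fin.suc (Fin.suc Fin.zero)) = z

allFaces : (n : Colour → ℕ) → List (Face n)
allFaces n = concatMap (λ x → concatMap (λ y → map (mk {n} x y) (opts (n c₃)))
                                         (opts (n c₂)))
                       (opts (n c₁))

count : (n : Colour → ℕ) → (Face n → Bool) → Subset 3 → ℕ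
count n isFace S =
  sum (map (λ σ → if isFace σ ∧ ⌊ ≡-dec B._≟_ (colours σ) S ⌋ then 1 else 0) (allFaces n))

-- A (finite) 3-coloured simplicial complex. Every element of Fin (n i) is a
-- vertex of colour i; faces are closed under taking subsets.

record Complex : Set where
  field
    n      : Colour → ℕ
    isFace : Face n → Bool
    down   : ∀ σ τ → τ ⊑ σ → T (isFace σ) → T (isFace τ)
    vertex : ∀ i (v : Fin (n i)) → T (isFace (single i v))

f : Complex → Subset 3 → ℕ
f Δ S = count (Complex.n Δ) (Complex.isFace Δ) S

pair : Colour → Colour → Subset 3
pair i j = ⁅ i ⁆ ∪ ⁅ j ⁆

record Params : Set where
  constructor params
  field
    g : Colour → ℕ
    p : Colour
    q : Colour

open Params public

swapPQ : Params → Params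
swapPQ P = params (g P) (q P) (p P)

_==_ : Colour → Colour → Bool
i == j = ⌊ i Fin.≟ j ⌋

module Construction (Δ : Complex) (P : Params) where
  gg = g P
  pp = p P
  qq = q P

  -- is v^p_{g_p+1} added?  is v^q_{g_q+1} added?
  addP addQ : Bool
  addP = gg pp <ᵇ f Δ ⁅ pp ⁆
  addQ = gg qq <ᵇ f Δ ⁅ qq ⁆

  ind : Bool → ℕ
  ind b = if b then 1 else 0

  nΓ : Colour → ℕ
  nΓ i = gg i + ind (addP ∧ (i == pp)) + ind (addQ ∧ (i == qq))

  -- k_c for the added p-vertex: edges of colour set {p,c} are g_p g_c + k_c,
  -- at most g_c vertices of colour c are present
  k₁ : Colour → ℕ
  k₁ c = (f Δ (pair pp c) ∸ gg pp * gg c) ⊓ gg c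

  -- vertices of colour c present when v^q_{g_q+1} is added
  present : Colour → ℕ
  present c = gg c + ind (addP ∧ (c == pp))

  -- edges of colour set {q,c} present before adding v^q_{g_q+1}
  edgesBefore : Colour → ℕ
  edgesBefore c = gg qq * gg c + (if addP ∧ (c == pp) then k₁ qq else 0)

  k₂ : Colour → ℕ
  k₂ c = (f Δ (pair qq c) ∸ edgesBefore c) ⊓ present c

  -- stage at which a vertex was added: 0 initial, 1 = v^p_{g_p+1}, 2 = v^q_{g_q+1}
  stage : Colour → ℕ → ℕ
  stage c a = if a <ᵇ gg c then 0 else (if c == pp then 1 else 2)

  kAt : ℕ → Colour → ℕ
  kAt 1 c = k₁ c
  kAt _ c = k₂ c

  adj : (c d : Colour) → ℕ → ℕ → Bool
  adj c d a b with stage c a | stage d b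
  ... | 0 | 0 = true
  ... | sa | sb =
    if sa <ᵇ sb then a <ᵇ kAt sb c
    else (if sb <ᵇ sa then b <ᵇ kAt sa d else false)

  pairOK : (c d : Colour) → Maybe (Fin (nΓ c)) → Maybe (Fin (nΓ d)) → Bool
  pairOK c d (just a) (just b) = adj c d (toℕ a) (toℕ b)
  pairOK c d _ _ = true

  isFaceΓ : Face nΓ → Bool
  isFaceΓ σ = pairOK c₁ c₂ (σ c₁) (σ c₂) ∧ pairOK c₁ c₃ (σ c₁) (σ c₃)
              ∧ pairOK c₂ c₃ (σ c₂) (σ c₃)

fΓ : Complex → Params → Subset 3 → ℕ
fΓ Δ P S = count (Construction.nΓ Δ P) (Construction.isFaceΓ Δ P) S

f123Γ : Complex → Params → ℕ
f123Γ Δ P = fΓ Δ P ⊤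

edgeSumΓ : Complex → Params → ℕ
edgeSumΓ Δ P = fΓ Δ P (pair c₁ c₂) + fΓ Δ P (pair c₁ c₃) + fΓ Δ P (pair c₂ c₃)

InA : Complex → Params → Set
InA Δ P = (∀ i → 0 < g P i) × (p P ≢ q P) × (∀ S → S ≢ ⊤ → fΓ Δ P S ≤ f Δ S)

InB : Complex → Params → Set
InB Δ P = InA Δ P × (∀ P' → InA Δ P' → f123Γ Δ P' ≤ f123Γ Δ P)

InC : Complex → Params → Set
InC Δ P = InB Δ P × (∀ P' → InB Δ P' → edgeSumΓ Δ P' ≤ edgeSumΓ Δ P)

InD : Complex → Params → Set
InD Δ P = InC Δ P ×
  (f123Γ Δ P < (f Δ ⁅ c₁ ⁆ * f Δ (pair c₂ c₃)) ⊓ (f Δ ⁅ c₂ ⁆ * f Δ (pair c₁ c₃))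
                 ⊓ (f Δ ⁅ c₃ ⁆ * f Δ (pair c₁ c₂)))

others : Colour → Subset 3
others Fin.zero = pair c₂ c₃
others (Fin.suc Fin.zero) = pair c₁ c₃
others (Fin.suc (Fin.suc Fin.zero)) = pair c₁ c₂

gProdOthers : Params → Colour → ℕ
gProdOthers P Fin.zero = g P c₂ * g P c₃
gProdOthers P (Fin.suc Fin.zero) = g P c₁ * g P c₃
gProdOthers P (Fin.suc (Fin.suc Fin.zero)) = g P c₁ * g P c₂

j : Complex → Params → Colour → ℤ
j Δ P i = + f Δ (others i) ℤ.- + gProdOthers P i

-- Γ and Γ₁ have the same initial vertices and differ only in the order in which the extra p- and
-- q-vertices are attached. Let r be the third colour and D = f_pq(Δ) − g_p g_q. Vertex numbers and
-- the {p,r}- and {q,r}-edges do not depend on the order, and neither does the number of {p,q}-edges,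
-- because D ⊓ g_q + (D ∸ g_q) ⊓ g_p = D ⊓ (g_p + g_q) = D ⊓ g_p + (D ∸ g_p) ⊓ g_q. The triangles
-- through the extra vertices number u·X + v·Y + t·M, where the extra q-vertex sees u initial
-- p-vertices and X vertices of colour r, the extra p-vertex sees v initial q-vertices and Y of colour
-- r, and t·M does not depend on the order. Attaching q first increases u and decreases v by the same amount, and j_p ≥ j_q says
-- exactly that X ≥ Y, so f_123 does not decrease. Since all other face numbers agree, membership in
-- 𝒜(Δ) and in 𝒟(Δ) carries over.

module Submission where

open import Defs
open import Data.Nat using (_<_; _≤_)
open import Data.Integer using (_≥_)
open import Data.Fin.Subset using (Subset)
open import Data.Product using (_×_; _,_; proj₁; proj₂)

open import Function using (_∘_)
open import Data.Nat using (ℕ; zero; suc; _+_; _*_; _∸_; _⊓_; _<ᵇ_; z≤n; s≤s)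
open import Data.Nat.Properties
open import Data.Bool as Bool using (Bool; true; false; if_then_else_; _∧_)
open import Data.Bool.Properties using (∧-identityʳ; ∧-zeroʳ; ∧-comm; ∧-assoc)
open import Data.Maybe using (Maybe; just; nothing; is-just)
open import Data.Fin.Subset using (⊤; ⁅_⁆)
open import Data.Fin.Subset.Properties using (∪-comm)
open import Data.List using (List; []; _∷_; map; concatMap; tabulate; allFin)
open import Data.List.Properties using (map-cong; map-∘; map-++; map-tabulate; tabulate-cong)
open import Data.Nat.ListAction using (sum)
open import Data.Nat.ListAction.Properties using (sum-++)
open import Data.Fin as Fin using (Fin; toℕ)
open import Data.Vec using ([]; _∷_)
open import Data.Vec.Properties using (≡-dec)
open import Relation.Nullary using (yes; no; contradiction)
open import Relation.Nullary.Decidable using (⌊_⌋; does; isYes≗does; dec-true; dec-false)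
open import Data.Sum using (_⊎_; inj₁; inj₂)
open import Relation.Binary.PropositionalEquality
open import Data.Nat.Tactic.RingSolver using (solve-∀)
open import Algebra.Properties.CommutativeSemigroup +-commutativeSemigroup using (interchange; xy∙z≈xz∙y)
import Data.Integer as ℤ
import Data.Integer.Properties as ℤ

-- Sums over ranges

ι : Bool → ℕ
ι b = if b then 1 else 0

infixr 7 _⊙_
_⊙_ : Bool → ℕ → ℕ
e ⊙ x = if e then x else 0

∑ : ℕ → (ℕ → ℕ) → ℕ
∑ zero    f = 0
∑ (suc n) f = f 0 + ∑ n (f ∘ suc)

syntax ∑ n (λ i → e) = ∑[ i < n ] e

∑-cong< : ∀ n {f g : ℕ → ℕ} → (∀ i → i < n → f i ≡ g i) → ∑ n f ≡ ∑ n g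
∑-cong< zero    eq = refl
∑-cong< (suc n) eq = cong₂ _+_ (eq 0 (s≤s z≤n)) (∑-cong< n (λ i i<n → eq (suc i) (s≤s i<n)))

∑-cong : ∀ n {f g : ℕ → ℕ} → (∀ i → f i ≡ g i) → ∑ n f ≡ ∑ n g
∑-cong n eq = ∑-cong< n (λ i _ → eq i)

∑-snoc : ∀ n (f : ℕ → ℕ) → ∑ (suc n) f ≡ ∑ n f + f n
∑-snoc zero    f = +-comm (f 0) 0
∑-snoc (suc n) f = trans (cong (f 0 +_) (∑-snoc n (f ∘ suc))) (sym (+-assoc (f 0) _ _))

∑-+ : ∀ n (f g : ℕ → ℕ) → ∑[ i < n ] (f i + g i) ≡ ∑ n f + ∑ n g
∑-+ zero    f g = refl
∑-+ (suc n) f g = trans (cong (f 0 + g 0 +_) (∑-+ n (f ∘ suc) (g ∘ suc))) (interchange (f 0) (g 0) _ _)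

∑-const : ∀ n k → ∑[ _ < n ] k ≡ n * k
∑-const zero    k = refl
∑-const (suc n) k = cong (k +_) (∑-const n k)

∑-ones : ∀ n → ∑[ _ < n ] 1 ≡ n
∑-ones n = trans (∑-const n 1) (*-identityʳ n)

∑-*ˡ : ∀ n k (f : ℕ → ℕ) → ∑[ i < n ] (k * f i) ≡ k * ∑ n f
∑-*ˡ zero    k f = sym (*-zeroʳ k)
∑-*ˡ (suc n) k f = trans (cong (k * f 0 +_) (∑-*ˡ n k (f ∘ suc))) (sym (*-distribˡ-+ k (f 0) _))

∑-*ʳ : ∀ n k (f : ℕ → ℕ) → ∑[ i < n ] (f i * k) ≡ ∑ n f * k
∑-*ʳ n k f = trans (∑-cong n (λ i → *-comm (f i) k)) (trans (∑-*ˡ n k f) (*-comm k _))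

∑-zeros : ∀ n → ∑[ _ < n ] 0 ≡ 0
∑-zeros n = trans (∑-const n 0) (*-zeroʳ n)

∑-⊙ : ∀ n e (f : ℕ → ℕ) → ∑[ i < n ] (e ⊙ f i) ≡ e ⊙ ∑ n f
∑-⊙ n true f = refl
∑-⊙ n false f = ∑-zeros n

∑-swap : ∀ m n (h : ℕ → ℕ → ℕ) → ∑[ i < m ] ∑[ j < n ] h i j ≡ ∑[ j < n ] ∑[ i < m ] h i j
∑-swap zero    n h = sym (∑-zeros n)
∑-swap (suc m) n h = trans (cong (∑ n (h 0) +_) (∑-swap m n (h ∘ suc))) (sym (∑-+ n (h 0) _))

∑-<ᵇ : ∀ n k → ∑[ i < n ] ι (i <ᵇ k) ≡ k ⊓ n
∑-<ᵇ zero    k       = sym (⊓-zeroʳ k)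
∑-<ᵇ (suc n) zero    = ∑-zeros n
∑-<ᵇ (suc n) (suc k) = cong suc (∑-<ᵇ n k)

∑-<ᵇ-⊓ : ∀ n m → ∑[ i < n ] ι (i <ᵇ m ⊓ n) ≡ m ⊓ n
∑-<ᵇ-⊓ n m = trans (∑-<ᵇ n (m ⊓ n)) (trans (⊓-assoc m n n) (cong (m ⊓_) (⊓-idem n)))

∑-extend : ∀ m e {f} g v → (∀ i → i < m → f i ≡ g i) → f m ≡ v → ∑ (m + ι e) f ≡ ∑ m g + e ⊙ v
∑-extend m true  {f} g v old new =
  trans (cong (λ k → ∑ k f) (+-comm m 1)) (trans (∑-snoc m f) (cong₂ _+_ (∑-cong< m old) new))
∑-extend m false {f} g v old new =
  trans (cong (λ k → ∑ k f) (+-identityʳ m)) (trans (∑-cong< m old) (sym (+-identityʳ _)))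

sum-tabulate-toℕ : ∀ n (h : ℕ → ℕ) → sum (tabulate {n = n} (h ∘ toℕ)) ≡ ∑ n h
sum-tabulate-toℕ zero    h = refl
sum-tabulate-toℕ (suc n) h = cong (h 0 +_) (sum-tabulate-toℕ n (h ∘ suc))

∑Fin-toℕ : ∀ n {F : Fin n → ℕ} (h : ℕ → ℕ) → (∀ a → F a ≡ h (toℕ a)) →
  sum (map F (allFin n)) ≡ ∑ n h
∑Fin-toℕ n h eq =
  trans (cong sum (trans (map-tabulate (λ a → a) _) (tabulate-cong eq))) (sum-tabulate-toℕ n h)

-- Counting faces by their colour set

sum-map-cong : ∀ {A : Set} {F G : A → ℕ} → (∀ a → F a ≡ G a) → ∀ l → sum (map F l) ≡ sum (map G l)
sum-map-cong eq l = cong sum (map-cong eq l)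

sum-concatMap : ∀ {A B : Set} (h : B → ℕ) (k : A → List B) l →
  sum (map h (concatMap k l)) ≡ sum (map (λ a → sum (map h (k a))) l)
sum-concatMap h k []      = refl
sum-concatMap h k (a ∷ l) = begin
  sum (map h (k a Data.List.++ concatMap k l))         ≡⟨ cong sum (map-++ h (k a) _) ⟩
  sum (map h (k a) Data.List.++ map h (concatMap k l)) ≡⟨ sum-++ (map h (k a)) _ ⟩
  sum (map h (k a)) + sum (map h (concatMap k l))      ≡⟨ cong (_ +_) (sum-concatMap h k l) ⟩
  _                                                    ∎
  where open ≡-Reasoning

sum-false⊙ : ∀ {A : Set} (G : A → ℕ) (l : List A) → sum (map (λ a → false ⊙ G a) l) ≡ 0
sum-false⊙ G []      = refl
sum-false⊙ G (_ ∷ l) = sum-false⊙ G l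

∑? : (n : ℕ) → (Maybe (Fin n) → ℕ) → ℕ
∑? n F = sum (map F (nothing ∷ map just (allFin n)))

∑?-cong : ∀ n {F G : Maybe (Fin n) → ℕ} → (∀ x → F x ≡ G x) → ∑? n F ≡ ∑? n G
∑?-cong n eq = sum-map-cong eq (nothing ∷ map just (allFin n))

∑?-⊙ : ∀ d n (F : Maybe (Fin n) → ℕ) → ∑? n (λ x → d ⊙ F x) ≡ d ⊙ ∑? n F
∑?-⊙ true  n F = refl
∑?-⊙ false n F = sum-false⊙ F (nothing ∷ map just (allFin n))

sum-triples : ∀ {X Y Z B : Set} (H : B → ℕ) (k : Maybe X → Maybe Y → Maybe Z → B)
  (xs : List X) (ys : List Y) (zs : List Z) →
  sum (map H (concatMap (λ x → concatMap (λ y → map (k x y) (nothing ∷ map just zs)) (nothing ∷ map just ys))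
                        (nothing ∷ map just xs)))
  ≡ sum (map (λ x → sum (map (λ y → sum (map (λ z → H (k x y z)) (nothing ∷ map just zs)))
                              (nothing ∷ map just ys))) (nothing ∷ map just xs))
sum-triples H k xs ys zs =
  trans (sum-concatMap H (λ x → concatMap (λ y → map (k x y) zs?) ys?) xs?) (sum-map-cong (λ x →
    trans (sum-concatMap H (λ y → map (k x y) zs?) ys?) (sum-map-cong (λ y →
      sym (cong sum (map-∘ {g = H} zs?))) ys?)) xs?)
  where
  xs? = nothing ∷ map just xs
  ys? = nothing ∷ map just ys
  zs? = nothing ∷ map just zs

sum-allFaces : ∀ n (h : Maybe (Fin (n c₁)) → Maybe (Fin (n c₂)) → Maybe (Fin (n c₃)) → ℕ) →
  sum (map (λ σ → h (σ c₁) (σ c₂) (σ c₃)) (allFaces n)) ≡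
  ∑? (n c₁) λ x → ∑? (n c₂) λ y → ∑? (n c₃) λ z → h x y z
sum-allFaces n h =
  sum-triples (λ (σ : Face n) → h (σ c₁) (σ c₂) (σ c₃)) _ (allFin (n c₁)) (allFin (n c₂)) (allFin (n c₃))

select : Bool → (n : ℕ) → (Maybe (Fin n) → ℕ) → ℕ
select true  n K = sum (map (K ∘ just) (allFin n))
select false n K = K nothing

∑?-select : ∀ d s n (K : Maybe (Fin n) → ℕ) →
  ∑? n (λ x → d ⊙ does (is-just x Bool.≟ s) ⊙ K x) ≡ d ⊙ select s n K
∑?-select d s n K = trans (∑?-⊙ d n _) (cong (d ⊙_) (selected s))
  where
  selected : ∀ s → ∑? n (λ x → does (is-just x Bool.≟ s) ⊙ K x) ≡ select s n K
  selected true  = sym (cong sum (map-∘ {g = λ x → does (is-just x Bool.≟ true) ⊙ K x} (allFin n)))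
  selected false = trans (cong (K nothing +_) (trans (sym (cong sum (map-∘ (allFin n))))
                                                     (sum-false⊙ (K ∘ just) (allFin n))))
                         (+-identityʳ (K nothing))

ι-∧-⊙ : ∀ b d₁ d₂ d₃ → ι (b ∧ (d₁ ∧ (d₂ ∧ (d₃ ∧ true)))) ≡ d₁ ⊙ d₂ ⊙ d₃ ⊙ ι b
ι-∧-⊙ b true  true  true  = cong ι (∧-identityʳ b)
ι-∧-⊙ b true  true  false = cong ι (∧-zeroʳ b)
ι-∧-⊙ b true  false _     = cong ι (∧-zeroʳ b)
ι-∧-⊙ b false _     _     = cong ι (∧-zeroʳ b)

ι-∧ : ∀ s t → ι (s ∧ t) ≡ ι s * ι t
ι-∧ true  true  = refl
ι-∧ true  false = refl
ι-∧ false t     = refl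

count-by-colours : ∀ n (ok : Maybe (Fin (n c₁)) → Maybe (Fin (n c₂)) → Maybe (Fin (n c₃)) → Bool)
  s₁ s₂ s₃ →
  count n (λ σ → ok (σ c₁) (σ c₂) (σ c₃)) (s₁ ∷ s₂ ∷ s₃ ∷ []) ≡
  select s₁ (n c₁) λ x → select s₂ (n c₂) λ y → select s₃ (n c₃) λ z → ι (ok x y z)
count-by-colours n ok s₁ s₂ s₃ =
  trans (sum-allFaces n _)
  (trans (∑?-cong (n c₁) λ x → trans (∑?-cong (n c₂) λ y →
            trans (∑?-cong (n c₃) λ z → indicator x y z)
                  (trans (∑?-⊙ (d₁ x) (n c₃) _) (cong (d₁ x ⊙_) (∑?-select (d₂ y) s₃ (n c₃) _))))
          (∑?-select (d₁ x) s₂ (n c₂) _))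
         (∑?-select true s₁ (n c₁) _))
  where
  d₁ = λ x → does (is-just x Bool.≟ s₁)
  d₂ = λ y → does (is-just y Bool.≟ s₂)
  d₃ = λ z → does (is-just z Bool.≟ s₃)
  indicator : ∀ x y z →
    ι (ok x y z ∧ ⌊ ≡-dec Bool._≟_ (is-just x ∷ is-just y ∷ is-just z ∷ []) (s₁ ∷ s₂ ∷ s₃ ∷ []) ⌋)
    ≡ d₁ x ⊙ d₂ y ⊙ d₃ z ⊙ ι (ok x y z)
  indicator x y z =
    trans (cong (λ b → ι (ok x y z ∧ b)) (isYes≗does _)) (ι-∧-⊙ (ok x y z) (d₁ x) (d₂ y) (d₃ z))

pattern col₁ = Fin.zero
pattern col₂ = Fin.suc Fin.zero
pattern col₃ = Fin.suc (Fin.suc Fin.zero)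

third : Colour → Colour → Colour
third col₁ col₂ = c₃
third col₂ col₁ = c₃
third col₁ col₃ = c₂
third col₃ col₁ = c₂
third _    _    = c₁

third-distinct : ∀ {p q} → p ≢ q → third p q ≢ p × third p q ≢ q
third-distinct {col₁} {col₁} p≢q = contradiction refl p≢q
third-distinct {col₂} {col₂} p≢q = contradiction refl p≢q
third-distinct {col₃} {col₃} p≢q = contradiction refl p≢q
third-distinct {col₁} {col₂} _ = (λ ()) , (λ ())
third-distinct {col₂} {col₁} _ = (λ ()) , (λ ())
third-distinct {col₁} {col₃} _ = (λ ()) , (λ ())
third-distinct {col₃} {col₁} _ = (λ ()) , (λ ())
third-distinct {col₂} {col₃} _ = (λ ()) , (λ ())
third-distinct {col₃} {col₂} _ = (λ ()) , (λ ())

colour-cases : ∀ {p q} → p ≢ q → ∀ c → c ≡ p ⊎ c ≡ q ⊎ c ≡ third p q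
colour-cases {col₁} {col₁} p≢q _ = contradiction refl p≢q
colour-cases {col₂} {col₂} p≢q _ = contradiction refl p≢q
colour-cases {col₃} {col₃} p≢q _ = contradiction refl p≢q
colour-cases {col₁} {col₂} _ col₁ = inj₁ refl
colour-cases {col₁} {col₂} _ col₂ = inj₂ (inj₁ refl)
colour-cases {col₁} {col₂} _ col₃ = inj₂ (inj₂ refl)
colour-cases {col₂} {col₁} _ col₁ = inj₂ (inj₁ refl)
colour-cases {col₂} {col₁} _ col₂ = inj₁ refl
colour-cases {col₂} {col₁} _ col₃ = inj₂ (inj₂ refl)
colour-cases {col₁} {col₃} _ col₁ = inj₁ refl
colour-cases {col₁} {col₃} _ col₂ = inj₂ (inj₂ refl)
colour-cases {col₁} {col₃} _ col₃ = inj₂ (inj₁ refl)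
colour-cases {col₃} {col₁} _ col₁ = inj₂ (inj₁ refl)
colour-cases {col₃} {col₁} _ col₂ = inj₂ (inj₂ refl)
colour-cases {col₃} {col₁} _ col₃ = inj₁ refl
colour-cases {col₂} {col₃} _ col₁ = inj₂ (inj₂ refl)
colour-cases {col₂} {col₃} _ col₂ = inj₁ refl
colour-cases {col₂} {col₃} _ col₃ = inj₂ (inj₁ refl)
colour-cases {col₃} {col₂} _ col₁ = inj₂ (inj₂ refl)
colour-cases {col₃} {col₂} _ col₂ = inj₂ (inj₁ refl)
colour-cases {col₃} {col₂} _ col₃ = inj₁ refl

is-third : ∀ {p q r} → p ≢ q → r ≢ p → r ≢ q → r ≡ third p q
is-third p≢q r≢p r≢q with colour-cases p≢q _
... | inj₁ r≡p        = contradiction r≡p r≢p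
... | inj₂ (inj₁ r≡q) = contradiction r≡q r≢q
... | inj₂ (inj₂ r≡t) = r≡t

==-refl : ∀ i → (i == i) ≡ true
==-refl i = trans (isYes≗does (i Fin.≟ i)) (dec-true (i Fin.≟ i) refl)

==-≢ : ∀ {i j} → i ≢ j → (i == j) ≡ false
==-≢ {i} {j} i≢j = trans (isYes≗does (i Fin.≟ j)) (dec-false (i Fin.≟ j) i≢j)

-- Edges and triangles of the constructed complex

module Counts (Δ : Complex) (P : Params) where
  open Construction Δ P

  -- adj with the stages of its ends as arguments, so that it computes once the stages are known
  -- (stage 0: initial vertex, 1: extra p-vertex, 2: extra q-vertex).
  adjAt : ℕ → ℕ → Colour → Colour → ℕ → ℕ → Bool
  adjAt 0 0 c d x y = true
  adjAt s t c d x y = if s <ᵇ t then x <ᵇ kAt t c else (if t <ᵇ s then y <ᵇ kAt s d else false)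

  adj≡adjAt : ∀ {c d x y s t} → stage c x ≡ s → stage d y ≡ t → adj c d x y ≡ adjAt s t c d x y
  adj≡adjAt {c} {d} {x} {y} refl refl with stage c x | stage d y
  ... | 0     | 0     = refl
  ... | 0     | suc _ = refl
  ... | suc _ | _     = refl

  adjAt-sym : ∀ s t c d x y → adjAt s t c d x y ≡ adjAt t s d c y x
  adjAt-sym 0       0       c d x y = refl
  adjAt-sym 0       (suc t) c d x y = refl
  adjAt-sym (suc s) 0       c d x y = refl
  adjAt-sym (suc s) (suc t) c d x y with s <ᵇ t in s<t | t <ᵇ s in t<s
  ... | true  | true  = contradiction (<ᵇ⇒< t s (subst Bool.T (sym t<s) _))
                                      (<⇒≯ (<ᵇ⇒< s t (subst Bool.T (sym s<t) _)))
  ... | true  | false = refl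
  ... | false | true  = refl
  ... | false | false = refl

  adj-sym : ∀ c d x y → adj c d x y ≡ adj d c y x
  adj-sym c d x y =
    trans (adj≡adjAt refl refl) (trans (adjAt-sym (stage c x) (stage d y) c d x y) (sym (adj≡adjAt refl refl)))

  edges : Colour → Colour → ℕ
  edges c d = ∑[ x < nΓ c ] ∑[ y < nΓ d ] ι (adj c d x y)

  triangles : Colour → Colour → Colour → ℕ
  triangles c d e =
    ∑[ x < nΓ c ] ∑[ y < nΓ d ] ∑[ z < nΓ e ] ι (adj c d x y ∧ adj c e x z ∧ adj d e y z)

  edges-sym : ∀ c d → edges c d ≡ edges d c
  edges-sym c d = trans (∑-swap (nΓ c) (nΓ d) _)
    (∑-cong (nΓ d) λ y → ∑-cong (nΓ c) λ x → cong ι (adj-sym c d x y))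

  triangles-swap₁₂ : ∀ c d e → triangles c d e ≡ triangles d c e
  triangles-swap₁₂ c d e = trans (∑-swap (nΓ c) (nΓ d) _)
    (∑-cong (nΓ d) λ y → ∑-cong (nΓ c) λ x → ∑-cong (nΓ e) λ z → cong ι
      (trans (cong (_∧ (adj c e x z ∧ adj d e y z)) (adj-sym c d x y))
             (swap-∧ (adj d c y x) (adj c e x z) (adj d e y z))))
    where
    swap-∧ : ∀ a b c → a ∧ b ∧ c ≡ a ∧ c ∧ b
    swap-∧ a b c = cong (a ∧_) (∧-comm b c)

  triangles-swap₂₃ : ∀ c d e → triangles c d e ≡ triangles c e d
  triangles-swap₂₃ c d e = ∑-cong (nΓ c) λ x → trans (∑-swap (nΓ d) (nΓ e) _)
    (∑-cong (nΓ e) λ z → ∑-cong (nΓ d) λ y → cong ι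
      (trans (swap-∧ (adj c d x y) (adj c e x z) (adj d e y z))
             (cong (λ w → adj c e x z ∧ adj c d x y ∧ w) (adj-sym d e y z))))
    where
    swap-∧ : ∀ a b c → a ∧ b ∧ c ≡ b ∧ a ∧ c
    swap-∧ a b c = trans (sym (∧-assoc a b c)) (trans (cong (_∧ c) (∧-comm a b)) (∧-assoc b a c))

  faceIndicator : Maybe (Fin (nΓ c₁)) → Maybe (Fin (nΓ c₂)) → Maybe (Fin (nΓ c₃)) → Bool
  faceIndicator x y z = pairOK c₁ c₂ x y ∧ pairOK c₁ c₃ x z ∧ pairOK c₂ c₃ y z

  fΓ-by-colours : ∀ s₁ s₂ s₃ → fΓ Δ P (s₁ ∷ s₂ ∷ s₃ ∷ []) ≡
    select s₁ (nΓ c₁) λ x → select s₂ (nΓ c₂) λ y → select s₃ (nΓ c₃) λ z → ι (faceIndicator x y z)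
  fΓ-by-colours = count-by-colours nΓ faceIndicator

  fΓ-∅ : fΓ Δ P Data.Fin.Subset.⊥ ≡ 1
  fΓ-∅ = fΓ-by-colours false false false

  count-ones : ∀ i → sum (map (λ _ → 1) (allFin (nΓ i))) ≡ nΓ i
  count-ones i = trans (∑Fin-toℕ (nΓ i) (λ _ → 1) (λ _ → refl)) (∑-ones (nΓ i))

  fΓ-vertex : ∀ i → fΓ Δ P ⁅ i ⁆ ≡ nΓ i
  fΓ-vertex col₁ = trans (fΓ-by-colours true false false) (count-ones c₁)
  fΓ-vertex col₂ = trans (fΓ-by-colours false true false) (count-ones c₂)
  fΓ-vertex col₃ = trans (fΓ-by-colours false false true) (count-ones c₃)

  fΓ-edges₁₂ : fΓ Δ P (pair c₁ c₂) ≡ edges c₁ c₂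
  fΓ-edges₁₂ = trans (fΓ-by-colours true true false)
    (∑Fin-toℕ (nΓ c₁) _ λ a →
     ∑Fin-toℕ (nΓ c₂) (λ y → ι (adj c₁ c₂ (toℕ a) y)) λ b → cong ι (∧-identityʳ _))

  fΓ-edges₁₃ : fΓ Δ P (pair c₁ c₃) ≡ edges c₁ c₃
  fΓ-edges₁₃ = trans (fΓ-by-colours true false true)
    (∑Fin-toℕ (nΓ c₁) _ λ a →
     ∑Fin-toℕ (nΓ c₃) (λ z → ι (adj c₁ c₃ (toℕ a) z)) λ c → cong ι (∧-identityʳ _))

  fΓ-edges₂₃ : fΓ Δ P (pair c₂ c₃) ≡ edges c₂ c₃
  fΓ-edges₂₃ = trans (fΓ-by-colours false true true)
    (∑Fin-toℕ (nΓ c₂) _ λ b → ∑Fin-toℕ (nΓ c₃) (λ z → ι (adj c₂ c₃ (toℕ b) z)) λ c → refl)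

  fΓ-triangles : fΓ Δ P ⊤ ≡ triangles c₁ c₂ c₃
  fΓ-triangles = trans (fΓ-by-colours true true true)
    (∑Fin-toℕ (nΓ c₁) _ λ a → ∑Fin-toℕ (nΓ c₂) (λ y → ∑[ z < nΓ c₃ ] triangle (toℕ a) y z) λ b →
                              ∑Fin-toℕ (nΓ c₃) (triangle (toℕ a) (toℕ b)) λ c → refl)
    where
    triangle : ℕ → ℕ → ℕ → ℕ
    triangle x y z = ι (adj c₁ c₂ x y ∧ adj c₁ c₃ x z ∧ adj c₂ c₃ y z)

  fΓ-pair : ∀ {c d} → c ≢ d → fΓ Δ P (pair c d) ≡ edges c d
  fΓ-pair {col₁} {col₁} c≢d = contradiction refl c≢d
  fΓ-pair {col₂} {col₂} c≢d = contradiction refl c≢d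
  fΓ-pair {col₃} {col₃} c≢d = contradiction refl c≢d
  fΓ-pair {col₁} {col₂} _ = fΓ-edges₁₂
  fΓ-pair {col₁} {col₃} _ = fΓ-edges₁₃
  fΓ-pair {col₂} {col₃} _ = fΓ-edges₂₃
  fΓ-pair {col₂} {col₁} _ = trans fΓ-edges₁₂ (edges-sym c₁ c₂)
  fΓ-pair {col₃} {col₁} _ = trans fΓ-edges₁₃ (edges-sym c₁ c₃)
  fΓ-pair {col₃} {col₂} _ = trans fΓ-edges₂₃ (edges-sym c₂ c₃)

  fΓ-⊤ : ∀ {p q r} → p ≢ q → r ≢ p → r ≢ q → fΓ Δ P ⊤ ≡ triangles p q r
  fΓ-⊤ {p} {q} p≢q r≢p r≢q =
    subst (λ r → fΓ Δ P ⊤ ≡ triangles p q r) (sym (is-third p≢q r≢p r≢q)) (trans fΓ-triangles (reorder p≢q))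
    where
    reorder : ∀ {p q} → p ≢ q → triangles c₁ c₂ c₃ ≡ triangles p q (third p q)
    reorder {col₁} {col₁} p≢q = contradiction refl p≢q
    reorder {col₂} {col₂} p≢q = contradiction refl p≢q
    reorder {col₃} {col₃} p≢q = contradiction refl p≢q
    reorder {col₁} {col₂} _ = refl
    reorder {col₂} {col₁} _ = triangles-swap₁₂ c₁ c₂ c₃
    reorder {col₁} {col₃} _ = triangles-swap₂₃ c₁ c₂ c₃
    reorder {col₃} {col₁} _ = trans (triangles-swap₂₃ c₁ c₂ c₃) (triangles-swap₁₂ c₁ c₃ c₂)
    reorder {col₂} {col₃} _ = trans (triangles-swap₁₂ c₁ c₂ c₃) (triangles-swap₂₃ c₂ c₁ c₃)
    reorder {col₃} {col₂} _ = trans (reorder {c₂} {c₃} (λ ())) (triangles-swap₁₂ c₂ c₃ c₁)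

-- The two attaching orders

m∸[m⊓n]≡m∸n : ∀ m n → m ∸ (m ⊓ n) ≡ m ∸ n
m∸[m⊓n]≡m∸n zero    n       = sym (0∸n≡0 n)
m∸[m⊓n]≡m∸n (suc m) zero    = refl
m∸[m⊓n]≡m∸n (suc m) (suc n) = m∸[m⊓n]≡m∸n m n

m⊓n+[m∸n]⊓o≡m⊓[n+o] : ∀ m n o → m ⊓ n + (m ∸ n) ⊓ o ≡ m ⊓ (n + o)
m⊓n+[m∸n]⊓o≡m⊓[n+o] m       zero    o = cong (_+ m ⊓ o) (⊓-zeroʳ m)
m⊓n+[m∸n]⊓o≡m⊓[n+o] zero    (suc n) o = refl
m⊓n+[m∸n]⊓o≡m⊓[n+o] (suc m) (suc n) o = cong suc (m⊓n+[m∸n]⊓o≡m⊓[n+o] m n o)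

[m⊓[n+1]]⊓n≡m⊓n : ∀ m n → (m ⊓ (n + 1)) ⊓ n ≡ m ⊓ n
[m⊓[n+1]]⊓n≡m⊓n m n = trans (⊓-assoc m (n + 1) n) (cong (m ⊓_) (m≥n⇒m⊓n≡n (m≤m+n n 1)))

n<ᵇm⊓[n+1]≡n<ᵇm : ∀ n m → (n <ᵇ m ⊓ (n + 1)) ≡ (n <ᵇ m)
n<ᵇm⊓[n+1]≡n<ᵇm zero    zero    = refl
n<ᵇm⊓[n+1]≡n<ᵇm zero    (suc m) = refl
n<ᵇm⊓[n+1]≡n<ᵇm (suc n) zero    = refl
n<ᵇm⊓[n+1]≡n<ᵇm (suc n) (suc m) = n<ᵇm⊓[n+1]≡n<ᵇm n m

m<ᵇn∸o≡m+o<ᵇn : ∀ m n o → (m <ᵇ n ∸ o) ≡ (m + o <ᵇ n)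
m<ᵇn∸o≡m+o<ᵇn m n       zero    = cong (_<ᵇ n) (sym (+-identityʳ m))
m<ᵇn∸o≡m+o<ᵇn m zero    (suc o) = refl
m<ᵇn∸o≡m+o<ᵇn m (suc n) (suc o) = trans (m<ᵇn∸o≡m+o<ᵇn m n o) (cong (_<ᵇ suc n) (sym (+-suc m o)))

exchange-≤ : ∀ {u u′ v v′ X Y} → u′ ≤ u → u′ + v′ ≡ u + v → Y ≤ X → u′ * X + v′ * Y ≤ u * X + v * Y
exchange-≤ {u} {u′} {v} {v′} {X} {Y} u′≤u sums Y≤X = begin
  u′ * X + v′ * Y          ≡⟨ cong (λ w → u′ * X + w * Y) v′≡d+v ⟩
  u′ * X + (d + v) * Y     ≡⟨ split u′ X d v Y ⟩
  u′ * X + v * Y + d * Y   ≤⟨ +-monoʳ-≤ (u′ * X + v * Y) (*-monoʳ-≤ d Y≤X) ⟩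
  u′ * X + v * Y + d * X   ≡⟨ merge u′ X d v Y ⟩
  (u′ + d) * X + v * Y     ≡⟨ cong (λ w → w * X + v * Y) (m+[n∸m]≡n u′≤u) ⟩
  u * X + v * Y            ∎
  where
  open ≤-Reasoning
  d = u ∸ u′
  split : ∀ u′ X d v Y → u′ * X + (d + v) * Y ≡ u′ * X + v * Y + d * Y
  split = solve-∀
  merge : ∀ u′ X d v Y → u′ * X + v * Y + d * X ≡ (u′ + d) * X + v * Y
  merge = solve-∀
  v′≡d+v : v′ ≡ d + v
  v′≡d+v = +-cancelˡ-≡ u′ v′ (d + v) (trans sums (trans (cong (_+ v) (sym (m+[n∸m]≡n u′≤u))) (+-assoc u′ d v)))

-- With the extra p-vertex attached (if eP) before the extra q-vertex (if eQ), the p-vertex sees D ⊓ b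
-- initial q-vertices, the q-vertex sees (D ∸ eP ⊙ b) ⊓ a initial p-vertices, and they are adjacent iff
-- a + b < D. In pqrTriangles, X and Y are the numbers of r-neighbours of the q- and the p-vertex and M
-- that of their common r-neighbours.
pqEdges : (a b D : ℕ) (eP eQ : Bool) → ℕ
pqEdges a b D eP eQ = a * b + eQ ⊙ ((D ∸ eP ⊙ b) ⊓ a) + eP ⊙ (D ⊓ b + eQ ⊙ ι (a + b <ᵇ D))

pqrTriangles : (a b c D : ℕ) (eP eQ : Bool) (X Y M : ℕ) → ℕ
pqrTriangles a b c D eP eQ X Y M =
  a * (b * c) + eQ ⊙ ((D ∸ eP ⊙ b) ⊓ a * X) + eP ⊙ (D ⊓ b * Y + eQ ⊙ (ι (a + b <ᵇ D) * M))

joins-total : ∀ a b D → (D ∸ b) ⊓ a + D ⊓ b ≡ D ⊓ a + (D ∸ a) ⊓ b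
joins-total a b D = begin
  (D ∸ b) ⊓ a + D ⊓ b ≡⟨ +-comm ((D ∸ b) ⊓ a) (D ⊓ b) ⟩
  D ⊓ b + (D ∸ b) ⊓ a ≡⟨ m⊓n+[m∸n]⊓o≡m⊓[n+o] D b a ⟩
  D ⊓ (b + a)         ≡⟨ cong (D ⊓_) (+-comm b a) ⟩
  D ⊓ (a + b)         ≡⟨ m⊓n+[m∸n]⊓o≡m⊓[n+o] D a b ⟨
  D ⊓ a + (D ∸ a) ⊓ b ∎
  where open ≡-Reasoning

pqEdges-swap : ∀ a b D eP eQ → pqEdges a b D eP eQ ≡ pqEdges b a D eQ eP
pqEdges-swap a b D false false = cong (λ m → m + 0 + 0) (*-comm a b)
pqEdges-swap a b D true  false = one-side (D ⊓ b) a b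
  where
  one-side : ∀ x a b → a * b + 0 + (x + 0) ≡ b * a + x + 0
  one-side = solve-∀
pqEdges-swap a b D false true  = sym (pqEdges-swap b a D true false)
pqEdges-swap a b D true  true  = begin
  a * b + u′ + (v′ + t)  ≡⟨ regroup (a * b) u′ v′ t ⟩
  a * b + (u′ + v′) + t  ≡⟨ cong (λ w → a * b + w + t) (joins-total a b D) ⟩
  a * b + (u + v) + t    ≡⟨ rearrange a b u v t ⟩
  b * a + v + (u + t)    ≡⟨ cong (λ s → b * a + v + (u + ι (s <ᵇ D))) (+-comm a b) ⟩
  b * a + v + (u + ι (b + a <ᵇ D)) ∎
  where
  open ≡-Reasoning
  u′ = (D ∸ b) ⊓ a
  v′ = D ⊓ b
  u  = D ⊓ a
  v  = (D ∸ a) ⊓ b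
  t  = ι (a + b <ᵇ D)
  regroup : ∀ m x y z → m + x + (y + z) ≡ m + (x + y) + z
  regroup = solve-∀
  rearrange : ∀ a b x y z → a * b + (x + y) + z ≡ b * a + y + (x + z)
  rearrange = solve-∀

pqrTriangles-swap-≤ : ∀ a b c D eP eQ {X Y} M → Y ≤ X →
  pqrTriangles a b c D eP eQ X Y M ≤ pqrTriangles b a c D eQ eP Y X M
pqrTriangles-swap-≤ a b c D false false M _ = ≤-reflexive (cong (λ m → m + 0 + 0) (reassoc a b c))
  where
  reassoc : ∀ a b c → a * (b * c) ≡ b * (a * c)
  reassoc = solve-∀
pqrTriangles-swap-≤ a b c D true  false {X} {Y} M _ = ≤-reflexive (one-side (D ⊓ b * Y) a b c)
  where
  one-side : ∀ x a b c → a * (b * c) + 0 + (x + 0) ≡ b * (a * c) + x + 0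
  one-side = solve-∀
pqrTriangles-swap-≤ a b c D false true  {X} {Y} M _ = ≤-reflexive (one-side (D ⊓ a * X) a b c)
  where
  one-side : ∀ x a b c → a * (b * c) + x + 0 ≡ b * (a * c) + 0 + (x + 0)
  one-side = solve-∀
pqrTriangles-swap-≤ a b c D true  true  {X} {Y} M Y≤X = begin
  a * (b * c) + u′ * X + (v′ * Y + t * M)  ≡⟨ regroup (a * (b * c)) (u′ * X) (v′ * Y) (t * M) ⟩
  a * (b * c) + (u′ * X + v′ * Y) + t * M  ≤⟨ +-monoˡ-≤ (t * M) (+-monoʳ-≤ (a * (b * c)) exchange) ⟩
  a * (b * c) + (u * X + v * Y) + t * M    ≡⟨ rearrange a b c (u * X) (v * Y) (t * M) ⟩
  b * (a * c) + v * Y + (u * X + t * M)    ≡⟨ cong (λ s → b * (a * c) + v * Y + (u * X + ι (s <ᵇ D) * M)) (+-comm a b) ⟩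
  b * (a * c) + v * Y + (u * X + ι (b + a <ᵇ D) * M) ∎
  where
  open ≤-Reasoning
  u′ = (D ∸ b) ⊓ a
  v′ = D ⊓ b
  u  = D ⊓ a
  v  = (D ∸ a) ⊓ b
  t  = ι (a + b <ᵇ D)
  regroup : ∀ m x y z → m + x + (y + z) ≡ m + (x + y) + z
  regroup = solve-∀
  rearrange : ∀ a b c x y z → a * (b * c) + (x + y) + z ≡ b * (a * c) + y + (x + z)
  rearrange = solve-∀
  exchange : u′ * X + v′ * Y ≤ u * X + v * Y
  exchange = exchange-≤ (⊓-monoˡ-≤ a (m∸n≤m D b)) (joins-total a b D) Y≤X

-- The value of k₂ p in the construction, in terms of D.
lateJoins : (a b D : ℕ) → Bool → ℕ
lateJoins a b D eP = (D ∸ eP ⊙ (D ⊓ b)) ⊓ (a + ι eP)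

lateJoins-initial : ∀ a b D eP → lateJoins a b D eP ⊓ a ≡ (D ∸ eP ⊙ b) ⊓ a
lateJoins-initial a b D false =
  trans (cong (λ n → (D ⊓ n) ⊓ a) (+-identityʳ a)) (trans (⊓-assoc D a a) (cong (D ⊓_) (⊓-idem a)))
lateJoins-initial a b D true =
  trans (cong (λ m → (m ⊓ (a + 1)) ⊓ a) (m∸[m⊓n]≡m∸n D b)) ([m⊓[n+1]]⊓n≡m⊓n (D ∸ b) a)

lateJoins-added : ∀ a b D → (a <ᵇ lateJoins a b D true) ≡ (a + b <ᵇ D)
lateJoins-added a b D =
  trans (cong (λ m → a <ᵇ m ⊓ (a + 1)) (m∸[m⊓n]≡m∸n D b))
        (trans (n<ᵇm⊓[n+1]≡n<ᵇm a (D ∸ b)) (m<ᵇn∸o≡m+o<ᵇn a D b))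

pqEdges-lateJoins : ∀ a b D eP eQ {k} → k ≡ lateJoins a b D eP →
  a * b + eQ ⊙ (k ⊓ a) + eP ⊙ (D ⊓ b + eQ ⊙ ι (a <ᵇ k)) ≡ pqEdges a b D eP eQ
pqEdges-lateJoins a b D false eQ refl = cong (λ w → a * b + eQ ⊙ w + 0) (lateJoins-initial a b D false)
pqEdges-lateJoins a b D true  eQ refl =
  cong₂ (λ w t → a * b + eQ ⊙ w + (D ⊓ b + eQ ⊙ ι t)) (lateJoins-initial a b D true) (lateJoins-added a b D)

pqrTriangles-lateJoins : ∀ a b c D eP eQ X Y M {k} → k ≡ lateJoins a b D eP →
  a * (b * c) + eQ ⊙ (k ⊓ a * X) + eP ⊙ (D ⊓ b * Y + eQ ⊙ (ι (a <ᵇ k) * M)) ≡ pqrTriangles a b c D eP eQ X Y M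
pqrTriangles-lateJoins a b c D false eQ X Y M refl =
  cong (λ w → a * (b * c) + eQ ⊙ (w * X) + 0) (lateJoins-initial a b D false)
pqrTriangles-lateJoins a b c D true  eQ X Y M refl =
  cong₂ (λ w t → a * (b * c) + eQ ⊙ (w * X) + (D ⊓ b * Y + eQ ⊙ (ι t * M)))
        (lateJoins-initial a b D true) (lateJoins-added a b D)

module ClosedForms (Δ : Complex) (P : Params) {r : Colour}
                   (p≢q : p P ≢ q P) (r≢p : r ≢ p P) (r≢q : r ≢ q P) where
  open Construction Δ P
  open Counts Δ P

  -- D: the {p,q}-edges left after the initial complete bipartite part; Zp, Zq: the r-neighbours of
  -- the extra p- and q-vertex; common: the r-vertices adjacent to both.
  a b c D Zp Zq common : ℕ
  a = g P pp
  b = g P qq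
  c = g P r
  D = f Δ (pair pp qq) ∸ a * b
  Zp = (f Δ (pair pp r) ∸ a * c) ⊓ c
  Zq = (f Δ (pair qq r) ∸ b * c) ⊓ c
  common = ∑[ z < c ] ι ((z <ᵇ Zp) ∧ (z <ᵇ Zq))

  addP∧[p==p] : addP ∧ (pp == pp) ≡ addP
  addP∧[p==p] = trans (cong (addP ∧_) (==-refl pp)) (∧-identityʳ addP)

  add∧[i==j] : ∀ (e : Bool) {i j} → i ≢ j → e ∧ (i == j) ≡ false
  add∧[i==j] e i≢j = trans (cong (e ∧_) (==-≢ i≢j)) (∧-zeroʳ e)

  nΓ-p : nΓ pp ≡ a + ι addP
  nΓ-p = trans (cong₂ (λ s t → a + ι s + ι t) addP∧[p==p] (add∧[i==j] addQ p≢q)) (+-identityʳ _)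

  nΓ-q : nΓ qq ≡ b + ι addQ
  nΓ-q = trans (cong₂ (λ s t → b + ι s + ι t) (add∧[i==j] addP (p≢q ∘ sym)) (trans (cong (addQ ∧_) (==-refl qq)) (∧-identityʳ addQ)))
               (cong (_+ ι addQ) (+-identityʳ b))

  nΓ-r : nΓ r ≡ c
  nΓ-r = trans (cong₂ (λ s t → c + ι s + ι t) (add∧[i==j] addP r≢p) (add∧[i==j] addQ r≢q))
               (trans (+-identityʳ _) (+-identityʳ c))

  stage-initial : ∀ {i x} → x < g P i → stage i x ≡ 0
  stage-initial {i} {x} x<g = cong (λ t → if t then 0 else (if i == pp then 1 else 2)) (dec-true (x <? g P i) x<g)

  stage-addedP : stage pp a ≡ 1
  stage-addedP = cong₂ (λ t u → if t then 0 else (if u then 1 else 2)) (dec-false (a <? a) (n≮n a)) (==-refl pp)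

  stage-addedQ : stage qq b ≡ 2
  stage-addedQ = cong₂ (λ t u → if t then 0 else (if u then 1 else 2)) (dec-false (b <? b) (n≮n b)) (==-≢ (p≢q ∘ sym))

  k₂-r : k₂ r ≡ Zq
  k₂-r = trans (cong (λ t → (f Δ (pair qq r) ∸ (b * c + (if t then k₁ qq else 0))) ⊓ (c + ι t)) (add∧[i==j] addP r≢p))
               (cong₂ (λ m n → (f Δ (pair qq r) ∸ m) ⊓ n) (+-identityʳ (b * c)) (+-identityʳ c))

  k₂-p : k₂ pp ≡ lateJoins a b D addP
  k₂-p = begin
    (f Δ (pair qq pp) ∸ edgesBefore pp) ⊓ present pp
      ≡⟨ cong₂ (λ t F → (F ∸ (b * a + t ⊙ k₁ qq)) ⊓ (a + ι t)) addP∧[p==p] (cong (f Δ) (∪-comm ⁅ qq ⁆ ⁅ pp ⁆)) ⟩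
    (f Δ (pair pp qq) ∸ (b * a + addP ⊙ (D ⊓ b))) ⊓ (a + ι addP)
      ≡⟨ cong (λ m → (f Δ (pair pp qq) ∸ (m + addP ⊙ (D ⊓ b))) ⊓ (a + ι addP)) (*-comm b a) ⟩
    (f Δ (pair pp qq) ∸ (a * b + addP ⊙ (D ⊓ b))) ⊓ (a + ι addP)
      ≡⟨ cong (_⊓ (a + ι addP)) (∸-+-assoc (f Δ (pair pp qq)) (a * b) _) ⟨
    (D ∸ addP ⊙ (D ⊓ b)) ⊓ (a + ι addP) ∎
    where open ≡-Reasoning

  adj-initial : ∀ {i j x y} → x < g P i → y < g P j → adj i j x y ≡ true
  adj-initial x<g y<g = adj≡adjAt (stage-initial x<g) (stage-initial y<g)

  adj-addedP : ∀ {j y} → y < g P j → adj pp j a y ≡ (y <ᵇ k₁ j)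
  adj-addedP y<g = adj≡adjAt stage-addedP (stage-initial y<g)

  adj-addedQ : ∀ {i x} → x < g P i → adj i qq x b ≡ (x <ᵇ k₂ i)
  adj-addedQ x<g = adj≡adjAt (stage-initial x<g) stage-addedQ

  adj-addedQ-r : ∀ {z} → z < c → adj qq r b z ≡ (z <ᵇ Zq)
  adj-addedQ-r z<c = trans (adj≡adjAt stage-addedQ (stage-initial z<c)) (cong (_ <ᵇ_) k₂-r)

  adj-addedP-addedQ : adj pp qq a b ≡ (a <ᵇ k₂ pp)
  adj-addedP-addedQ = adj≡adjAt stage-addedP stage-addedQ

  edges-p-r : edges pp r ≡ a * c + addP ⊙ Zp
  edges-p-r = begin
    ∑[ x < nΓ pp ] ∑[ z < nΓ r ] ι (adj pp r x z)
      ≡⟨ cong₂ (λ m n → ∑[ x < m ] ∑[ z < n ] ι (adj pp r x z)) nΓ-p nΓ-r ⟩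
    ∑[ x < a + ι addP ] ∑[ z < c ] ι (adj pp r x z)
      ≡⟨ ∑-extend a addP (λ _ → c) Zp initialRow addedRow ⟩
    ∑[ _ < a ] c + addP ⊙ Zp
      ≡⟨ cong (_+ addP ⊙ Zp) (∑-const a c) ⟩
    a * c + addP ⊙ Zp ∎
    where
    open ≡-Reasoning
    initialRow : ∀ x → x < a → ∑[ z < c ] ι (adj pp r x z) ≡ c
    initialRow x x<a = trans (∑-cong< c λ z z<c → cong ι (adj-initial x<a z<c)) (∑-ones c)
    addedRow : ∑[ z < c ] ι (adj pp r a z) ≡ Zp
    addedRow = trans (∑-cong< c λ z z<c → cong ι (adj-addedP z<c)) (∑-<ᵇ-⊓ c _)

  edges-q-r : edges qq r ≡ b * c + addQ ⊙ Zq
  edges-q-r = begin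
    ∑[ y < nΓ qq ] ∑[ z < nΓ r ] ι (adj qq r y z)
      ≡⟨ cong₂ (λ m n → ∑[ y < m ] ∑[ z < n ] ι (adj qq r y z)) nΓ-q nΓ-r ⟩
    ∑[ y < b + ι addQ ] ∑[ z < c ] ι (adj qq r y z)
      ≡⟨ ∑-extend b addQ (λ _ → c) Zq initialRow addedRow ⟩
    ∑[ _ < b ] c + addQ ⊙ Zq
      ≡⟨ cong (_+ addQ ⊙ Zq) (∑-const b c) ⟩
    b * c + addQ ⊙ Zq ∎
    where
    open ≡-Reasoning
    initialRow : ∀ y → y < b → ∑[ z < c ] ι (adj qq r y z) ≡ c
    initialRow y y<b = trans (∑-cong< c λ z z<c → cong ι (adj-initial y<b z<c)) (∑-ones c)
    addedRow : ∑[ z < c ] ι (adj qq r b z) ≡ Zq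
    addedRow = trans (∑-cong< c λ z z<c → cong ι (adj-addedQ-r z<c)) (∑-<ᵇ-⊓ c _)

  edges-p-q : edges pp qq ≡ pqEdges a b D addP addQ
  edges-p-q = begin
    ∑[ x < nΓ pp ] ∑[ y < nΓ qq ] ι (adj pp qq x y)
      ≡⟨ cong₂ (λ m n → ∑[ x < m ] ∑[ y < n ] ι (adj pp qq x y)) nΓ-p nΓ-q ⟩
    ∑[ x < a + ι addP ] ∑[ y < b + ι addQ ] ι (adj pp qq x y)
      ≡⟨ ∑-extend a addP (λ x → b + addQ ⊙ ι (x <ᵇ k₂ pp)) _ initialRow addedRow ⟩
    ∑[ x < a ] (b + addQ ⊙ ι (x <ᵇ k₂ pp)) + addP ⊙ (D ⊓ b + addQ ⊙ ι (a <ᵇ k₂ pp))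
      ≡⟨ cong (_+ addP ⊙ (D ⊓ b + addQ ⊙ ι (a <ᵇ k₂ pp))) initialRows ⟩
    a * b + addQ ⊙ (k₂ pp ⊓ a) + addP ⊙ (D ⊓ b + addQ ⊙ ι (a <ᵇ k₂ pp))
      ≡⟨ pqEdges-lateJoins a b D addP addQ k₂-p ⟩
    pqEdges a b D addP addQ ∎
    where
    open ≡-Reasoning
    initialRow : ∀ x → x < a → ∑[ y < b + ι addQ ] ι (adj pp qq x y) ≡ b + addQ ⊙ ι (x <ᵇ k₂ pp)
    initialRow x x<a =
      trans (∑-extend b addQ (λ _ → 1) _ (λ y y<b → cong ι (adj-initial x<a y<b)) (cong ι (adj-addedQ x<a)))
            (cong (_+ addQ ⊙ ι (x <ᵇ k₂ pp)) (∑-ones b))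
    addedRow : ∑[ y < b + ι addQ ] ι (adj pp qq a y) ≡ D ⊓ b + addQ ⊙ ι (a <ᵇ k₂ pp)
    addedRow =
      trans (∑-extend b addQ (λ y → ι (y <ᵇ D ⊓ b)) _ (λ y y<b → cong ι (adj-addedP y<b)) (cong ι adj-addedP-addedQ))
            (cong (_+ addQ ⊙ ι (a <ᵇ k₂ pp)) (∑-<ᵇ-⊓ b D))
    initialRows : ∑[ x < a ] (b + addQ ⊙ ι (x <ᵇ k₂ pp)) ≡ a * b + addQ ⊙ (k₂ pp ⊓ a)
    initialRows = trans (∑-+ a (λ _ → b) _)
      (cong₂ _+_ (∑-const a b) (trans (∑-⊙ a addQ _) (cong (addQ ⊙_) (∑-<ᵇ a (k₂ pp)))))

  triangle : ℕ → ℕ → ℕ → ℕ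
  triangle x y z = ι (adj pp qq x y ∧ adj pp r x z ∧ adj qq r y z)

  initialPRow : ∀ x → x < a → ∑[ y < b + ι addQ ] ∑[ z < c ] triangle x y z ≡ b * c + addQ ⊙ (ι (x <ᵇ k₂ pp) * Zq)
  initialPRow x x<a =
    trans (∑-extend b addQ (λ _ → c) _ (λ y y<b → trans (∑-cong< c λ z z<c → allInitial y<b z<c) (∑-ones c)) addedQ)
          (cong (_+ addQ ⊙ (ι (x <ᵇ k₂ pp) * Zq)) (∑-const b c))
    where
    allInitial : ∀ {y z} → y < b → z < c → triangle x y z ≡ 1
    allInitial y<b z<c =
      cong ι (cong₂ _∧_ (adj-initial x<a y<b) (cong₂ _∧_ (adj-initial x<a z<c) (adj-initial y<b z<c)))
    addedQ : ∑[ z < c ] triangle x b z ≡ ι (x <ᵇ k₂ pp) * Zq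
    addedQ = trans (∑-cong< c λ z z<c →
                     trans (cong ι (cong₂ _∧_ (adj-addedQ x<a) (cong₂ _∧_ (adj-initial x<a z<c) (adj-addedQ-r z<c))))
                           (ι-∧ (x <ᵇ k₂ pp) (z <ᵇ Zq)))
                   (trans (∑-*ˡ c (ι (x <ᵇ k₂ pp)) (λ z → ι (z <ᵇ Zq))) (cong (ι (x <ᵇ k₂ pp) *_) (∑-<ᵇ-⊓ c _)))

  addedPRow : ∑[ y < b + ι addQ ] ∑[ z < c ] triangle a y z ≡ D ⊓ b * Zp + addQ ⊙ (ι (a <ᵇ k₂ pp) * common)
  addedPRow =
    trans (∑-extend b addQ (λ y → ι (y <ᵇ D ⊓ b) * Zp) _ (λ y y<b → initialQ y<b) addedQ)
          (cong (_+ addQ ⊙ (ι (a <ᵇ k₂ pp) * common)) (trans (∑-*ʳ b Zp _) (cong (_* Zp) (∑-<ᵇ-⊓ b D))))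
    where
    initialQ : ∀ {y} → y < b → ∑[ z < c ] triangle a y z ≡ ι (y <ᵇ D ⊓ b) * Zp
    initialQ {y} y<b =
      trans (∑-cong< c λ z z<c →
               trans (cong ι (cong₂ _∧_ (adj-addedP y<b)
                                        (trans (cong₂ _∧_ (adj-addedP z<c) (adj-initial y<b z<c)) (∧-identityʳ _))))
                     (ι-∧ (y <ᵇ D ⊓ b) (z <ᵇ Zp)))
            (trans (∑-*ˡ c (ι (y <ᵇ D ⊓ b)) (λ z → ι (z <ᵇ Zp))) (cong (ι (y <ᵇ D ⊓ b) *_) (∑-<ᵇ-⊓ c _)))
    addedQ : ∑[ z < c ] triangle a b z ≡ ι (a <ᵇ k₂ pp) * common
    addedQ = trans (∑-cong< c λ z z<c →
                     trans (cong ι (cong₂ _∧_ adj-addedP-addedQ (cong₂ _∧_ (adj-addedP z<c) (adj-addedQ-r z<c))))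
                           (ι-∧ (a <ᵇ k₂ pp) _))
                   (∑-*ˡ c (ι (a <ᵇ k₂ pp)) (λ z → ι ((z <ᵇ Zp) ∧ (z <ᵇ Zq))))

  triangles-p-q-r : triangles pp qq r ≡ pqrTriangles a b c D addP addQ Zq Zp common
  triangles-p-q-r = begin
    ∑[ x < nΓ pp ] ∑[ y < nΓ qq ] ∑[ z < nΓ r ] triangle x y z
      ≡⟨ cong₃ (λ l m n → ∑[ x < l ] ∑[ y < m ] ∑[ z < n ] triangle x y z) nΓ-p nΓ-q nΓ-r ⟩
    ∑[ x < a + ι addP ] ∑[ y < b + ι addQ ] ∑[ z < c ] triangle x y z
      ≡⟨ ∑-extend a addP _ _ initialPRow addedPRow ⟩
    ∑[ x < a ] (b * c + addQ ⊙ (ι (x <ᵇ k₂ pp) * Zq)) + addP ⊙ (D ⊓ b * Zp + addQ ⊙ (ι (a <ᵇ k₂ pp) * common))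
      ≡⟨ cong (_+ addP ⊙ (D ⊓ b * Zp + addQ ⊙ (ι (a <ᵇ k₂ pp) * common))) initialRows ⟩
    a * (b * c) + addQ ⊙ (k₂ pp ⊓ a * Zq) + addP ⊙ (D ⊓ b * Zp + addQ ⊙ (ι (a <ᵇ k₂ pp) * common))
      ≡⟨ pqrTriangles-lateJoins a b c D addP addQ Zq Zp common k₂-p ⟩
    pqrTriangles a b c D addP addQ Zq Zp common ∎
    where
    open ≡-Reasoning
    cong₃ : ∀ (h : ℕ → ℕ → ℕ → ℕ) {l l′ m m′ n n′} → l ≡ l′ → m ≡ m′ → n ≡ n′ → h l m n ≡ h l′ m′ n′
    cong₃ h refl refl refl = refl
    initialRows : ∑[ x < a ] (b * c + addQ ⊙ (ι (x <ᵇ k₂ pp) * Zq)) ≡ a * (b * c) + addQ ⊙ (k₂ pp ⊓ a * Zq)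
    initialRows = trans (∑-+ a (λ _ → b * c) _) (cong₂ _+_ (∑-const a (b * c))
      (trans (∑-⊙ a addQ _) (cong (addQ ⊙_) (trans (∑-*ʳ a Zq _) (cong (_* Zq) (∑-<ᵇ a (k₂ pp)))))))

-- Swapping p and q

symmetric-agree : ∀ {E E′ : Colour → Colour → ℕ} {p q} → p ≢ q →
  (∀ c d → E c d ≡ E d c) → (∀ c d → E′ c d ≡ E′ d c) →
  E′ p q ≡ E p q → E′ p (third p q) ≡ E p (third p q) → E′ q (third p q) ≡ E q (third p q) →
  ∀ {c d} → c ≢ d → E′ c d ≡ E c d
symmetric-agree {E} {E′} p≢q E-sym E′-sym epq epr eqr {c} {d} c≢d with colour-cases p≢q c | colour-cases p≢q d
... | inj₁ refl        | inj₁ refl        = contradiction refl c≢d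
... | inj₁ refl        | inj₂ (inj₁ refl) = epq
... | inj₁ refl        | inj₂ (inj₂ refl) = epr
... | inj₂ (inj₁ refl) | inj₁ refl        = trans (E′-sym _ _) (trans epq (E-sym _ _))
... | inj₂ (inj₁ refl) | inj₂ (inj₁ refl) = contradiction refl c≢d
... | inj₂ (inj₁ refl) | inj₂ (inj₂ refl) = eqr
... | inj₂ (inj₂ refl) | inj₁ refl        = trans (E′-sym _ _) (trans epr (E-sym _ _))
... | inj₂ (inj₂ refl) | inj₂ (inj₁ refl) = trans (E′-sym _ _) (trans eqr (E-sym _ _))
... | inj₂ (inj₂ refl) | inj₂ (inj₂ refl) = contradiction refl c≢d

others-pair : ∀ {i k l} → i ≢ k → l ≢ i → l ≢ k → others i ≡ pair k l
others-pair {i} {k} i≢k l≢i l≢k = subst (λ l → others i ≡ pair k l) (sym (is-third i≢k l≢i l≢k)) (table i≢k)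
  where
  table : ∀ {i k} → i ≢ k → others i ≡ pair k (third i k)
  table {col₁} {col₁} i≢k = contradiction refl i≢k
  table {col₂} {col₂} i≢k = contradiction refl i≢k
  table {col₃} {col₃} i≢k = contradiction refl i≢k
  table {col₁} {col₂} _ = refl
  table {col₁} {col₃} _ = refl
  table {col₂} {col₁} _ = refl
  table {col₂} {col₃} _ = refl
  table {col₃} {col₁} _ = refl
  table {col₃} {col₂} _ = refl

gProdOthers-pair : ∀ P {i k l} → i ≢ k → l ≢ i → l ≢ k → gProdOthers P i ≡ g P k * g P l
gProdOthers-pair P {i} {k} i≢k l≢i l≢k =
  subst (λ l → gProdOthers P i ≡ g P k * g P l) (sym (is-third i≢k l≢i l≢k)) (table i≢k)
  where
  table : ∀ {i k} → i ≢ k → gProdOthers P i ≡ g P k * g P (third i k)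
  table {col₁} {col₁} i≢k = contradiction refl i≢k
  table {col₂} {col₂} i≢k = contradiction refl i≢k
  table {col₃} {col₃} i≢k = contradiction refl i≢k
  table {col₁} {col₂} _ = refl
  table {col₁} {col₃} _ = *-comm (g P c₂) (g P c₃)
  table {col₂} {col₁} _ = refl
  table {col₂} {col₃} _ = *-comm (g P c₁) (g P c₃)
  table {col₃} {col₁} _ = refl
  table {col₃} {col₂} _ = *-comm (g P c₁) (g P c₂)

m-n≤o-p⇒m∸n≤o∸p : ∀ m n o p → ℤ.+ m ℤ.- ℤ.+ n ℤ.≤ ℤ.+ o ℤ.- ℤ.+ p → m ∸ n ≤ o ∸ p
m-n≤o-p⇒m∸n≤o∸p m n o p le with n ≤? m | p ≤? o
... | no n≰m | _ = subst (_≤ o ∸ p) (sym (m≤n⇒m∸n≡0 (<⇒≤ (≰⇒> n≰m)))) z≤n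
... | yes n≤m | yes p≤o = ℤ.drop‿+≤+ (subst₂ ℤ._≤_ (as-∸ n≤m) (as-∸ p≤o) le)
  where
  as-∸ : ∀ {x y} → y ≤ x → ℤ.+ x ℤ.- ℤ.+ y ≡ ℤ.+ (x ∸ y)
  as-∸ {x} {y} y≤x = trans (ℤ.m-n≡m⊖n x y) (ℤ.⊖-≥ y≤x)
... | yes n≤m | no p≰o = ≤-trans (ℤ.drop‿+≤+ (ℤ.≤-trans le′ (ℤ.neg-mono-≤ (ℤ.+≤+ z≤n)))) z≤n
  where
  le′ : ℤ.+ (m ∸ n) ℤ.≤ ℤ.- ℤ.+ (p ∸ o)
  le′ = subst₂ ℤ._≤_ (trans (ℤ.m-n≡m⊖n m n) (ℤ.⊖-≥ n≤m)) (trans (ℤ.m-n≡m⊖n o p) (ℤ.⊖-≤ (<⇒≤ (≰⇒> p≰o)))) le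

j-pair : ∀ Δ P {i k l} → i ≢ k → l ≢ i → l ≢ k → j Δ P i ≡ ℤ.+ f Δ (pair k l) ℤ.- ℤ.+ (g P k * g P l)
j-pair Δ P i≢k l≢i l≢k =
  cong₂ (λ S n → ℤ.+ f Δ S ℤ.- ℤ.+ n) (others-pair i≢k l≢i l≢k) (gProdOthers-pair P i≢k l≢i l≢k)

InA-transfer : ∀ {Δ P P′} → InA Δ P → (∀ i → 0 < g P′ i) → p P′ ≢ q P′ →
  (∀ S → S ≢ ⊤ → fΓ Δ P′ S ≡ fΓ Δ P S) → InA Δ P′
InA-transfer {Δ} (_ , _ , bounded) g>0 p≢q agree =
  g>0 , p≢q , λ S S≢⊤ → subst (_≤ f Δ S) (sym (agree S S≢⊤)) (bounded S S≢⊤)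

InD-transfer : ∀ {Δ P P′} → InA Δ P′ → f123Γ Δ P ≤ f123Γ Δ P′ →
  (∀ S → S ≢ ⊤ → fΓ Δ P′ S ≡ fΓ Δ P S) → InD Δ P → InD Δ P′
InD-transfer {Δ} {P} {P′} inA′ f123≤ agree (((_ , maximal) , edgeMaximal) , belowBound) =
  ((inA′ , λ P″ inA″ → ≤-trans (maximal P″ inA″) f123≤) ,
   λ P″ inB″ → subst (edgeSumΓ Δ P″ ≤_) (sym sameEdgeSum) (edgeMaximal P″ inB″)) ,
  ≤-<-trans (maximal P′ inA′) belowBound
  where
  sameEdgeSum : edgeSumΓ Δ P′ ≡ edgeSumΓ Δ P
  sameEdgeSum =
    cong₂ _+_ (cong₂ _+_ (agree (pair c₁ c₂) (λ ())) (agree (pair c₁ c₃) (λ ()))) (agree (pair c₂ c₃) (λ ()))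

module Swap (Δ : Complex) (Γ : Params) (p≢q : p Γ ≢ q Γ) where
  Γ₁ : Params
  Γ₁ = swapPQ Γ

  r : Colour
  r = third (p Γ) (q Γ)

  r≢p : r ≢ p Γ
  r≢p = proj₁ (third-distinct p≢q)

  r≢q : r ≢ q Γ
  r≢q = proj₂ (third-distinct p≢q)

  open Construction Δ Γ using (nΓ; addP; addQ)
  open ClosedForms Δ Γ p≢q r≢p r≢q
    using (a; b; c; D; Zp; Zq; common; edges-p-q; edges-p-r; edges-q-r; triangles-p-q-r)
  module R₁ = ClosedForms Δ Γ₁ (p≢q ∘ sym) r≢q r≢p
  module C  = Counts Δ Γ
  module C₁ = Counts Δ Γ₁

  D₁≡D : R₁.D ≡ D
  D₁≡D = cong₂ _∸_ (cong (f Δ) (∪-comm ⁅ q Γ ⁆ ⁅ p Γ ⁆)) (*-comm b a)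

  common₁≡common : R₁.common ≡ common
  common₁≡common = ∑-cong c λ z → cong ι (∧-comm (z <ᵇ Zq) (z <ᵇ Zp))

  nΓ₁≡nΓ : ∀ i → Construction.nΓ Δ Γ₁ i ≡ nΓ i
  nΓ₁≡nΓ i = xy∙z≈xz∙y (g Γ i) _ _

  edges₁≡edges : ∀ {d e} → d ≢ e → C₁.edges d e ≡ C.edges d e
  edges₁≡edges = symmetric-agree p≢q C.edges-sym C₁.edges-sym
    (trans (C₁.edges-sym (p Γ) (q Γ)) (begin
      C₁.edges (q Γ) (p Γ)      ≡⟨ R₁.edges-p-q ⟩
      pqEdges b a R₁.D addQ addP ≡⟨ cong (λ D′ → pqEdges b a D′ addQ addP) D₁≡D ⟩
      pqEdges b a D addQ addP    ≡⟨ pqEdges-swap a b D addP addQ ⟨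
      pqEdges a b D addP addQ    ≡⟨ edges-p-q ⟨
      C.edges (p Γ) (q Γ)       ∎))
    (trans R₁.edges-q-r (sym edges-p-r))
    (trans R₁.edges-p-r (sym edges-q-r))
    where open ≡-Reasoning

  edge-count : ∀ {d e} → d ≢ e → fΓ Δ Γ₁ (pair d e) ≡ fΓ Δ Γ (pair d e)
  edge-count d≢e = trans (C₁.fΓ-pair d≢e) (trans (edges₁≡edges d≢e) (sym (C.fΓ-pair d≢e)))

  vertex-count : ∀ i → fΓ Δ Γ₁ ⁅ i ⁆ ≡ fΓ Δ Γ ⁅ i ⁆
  vertex-count i = trans (C₁.fΓ-vertex i) (trans (nΓ₁≡nΓ i) (sym (C.fΓ-vertex i)))

  fΓ₁≡fΓ : ∀ S → S ≢ ⊤ → fΓ Δ Γ₁ S ≡ fΓ Δ Γ S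
  fΓ₁≡fΓ (true  ∷ true  ∷ true  ∷ []) S≢⊤ = contradiction refl S≢⊤
  fΓ₁≡fΓ (true  ∷ true  ∷ false ∷ []) _ = edge-count {c₁} {c₂} (λ ())
  fΓ₁≡fΓ (true  ∷ false ∷ true  ∷ []) _ = edge-count {c₁} {c₃} (λ ())
  fΓ₁≡fΓ (false ∷ true  ∷ true  ∷ []) _ = edge-count {c₂} {c₃} (λ ())
  fΓ₁≡fΓ (true  ∷ false ∷ false ∷ []) _ = vertex-count c₁
  fΓ₁≡fΓ (false ∷ true  ∷ false ∷ []) _ = vertex-count c₂
  fΓ₁≡fΓ (false ∷ false ∷ true  ∷ []) _ = vertex-count c₃
  fΓ₁≡fΓ (false ∷ false ∷ false ∷ []) _ = trans C₁.fΓ-∅ (sym C.fΓ-∅)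

  f123-swap-≤ : Zp ≤ Zq → f123Γ Δ Γ ≤ f123Γ Δ Γ₁
  f123-swap-≤ Zp≤Zq = begin
    f123Γ Δ Γ                                        ≡⟨ C.fΓ-⊤ p≢q r≢p r≢q ⟩
    C.triangles (p Γ) (q Γ) r                       ≡⟨ triangles-p-q-r ⟩
    pqrTriangles a b c D addP addQ Zq Zp common      ≤⟨ pqrTriangles-swap-≤ a b c D addP addQ common Zp≤Zq ⟩
    pqrTriangles b a c D addQ addP Zp Zq common
      ≡⟨ cong₂ (λ D′ M → pqrTriangles b a c D′ addQ addP Zp Zq M) D₁≡D common₁≡common ⟨
    pqrTriangles b a c R₁.D addQ addP Zp Zq R₁.common ≡⟨ R₁.triangles-p-q-r ⟨
    C₁.triangles (q Γ) (p Γ) r                      ≡⟨ C₁.fΓ-⊤ (p≢q ∘ sym) r≢q r≢p ⟨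
    f123Γ Δ Γ₁                                       ∎
    where open ≤-Reasoning

  j-ordered⇒Zp≤Zq : j Δ Γ (p Γ) ℤ.≥ j Δ Γ (q Γ) → Zp ≤ Zq
  j-ordered⇒Zp≤Zq jp≥jq =
    ⊓-monoˡ-≤ c (m-n≤o-p⇒m∸n≤o∸p (f Δ (pair (p Γ) r)) (a * c) (f Δ (pair (q Γ) r)) (b * c)
      (subst₂ ℤ._≤_ (j-pair Δ Γ (p≢q ∘ sym) r≢q r≢p) (j-pair Δ Γ p≢q r≢p r≢q) jp≥jq))

lemma2p11 : (Δ : Complex) → (∀ (S : Subset 3) → 0 < f Δ S) →
    (Γ : Params) → InA Δ Γ → j Δ Γ (p Γ) ≥ j Δ Γ (q Γ) →
    InA Δ (swapPQ Γ) × f123Γ Δ Γ ≤ f123Γ Δ (swapPQ Γ) ×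
    (InD Δ Γ → InD Δ (swapPQ Γ))
lemma2p11 Δ _ Γ inA@(g>0 , p≢q , _) jp≥jq = inA₁ , f123≤ , InD-transfer inA₁ f123≤ fΓ₁≡fΓ
  where
  open Swap Δ Γ p≢q
  inA₁ : InA Δ Γ₁
  inA₁ = InA-transfer inA g>0 (p≢q ∘ sym) fΓ₁≡fΓ
  f123≤ : f123Γ Δ Γ ≤ f123Γ Δ Γ₁
  f123≤ = f123-swap-≤ (j-ordered⇒Zp≤Zq jp≥jq)
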